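{- Let $\mathcal{M}$ be a convergent automaton such that a counting automaton of $\mathcal{M}$, presented with transitions in parallel, has finitely many visible states $q_0,q_1,\ldots,q_r$ ($q_0$ the initial state), and from each visible state only finitely many transitions in parallel start. For $0\le t\le r$ let $f_1^{q_t}(z),\ldots,f_{s(t)}^{q_t}(z)$ be the transitions in parallel leaving $q_t$, and let $q_{t_k}$ be the visible state to which $f_k^{q_t}$ leads. For each visible state $q$ let $L(q)(z)=\sum_{n\ge0}a_n^q z^n$, where $a_n^q$ is the number of words of length $n$ accepted by $\mathcal{M}$ (counted with repetition) when $q$ is taken as the initial state. Then the generating function of the language $L(\mathcal{M})$ is $L(q_0)(z)$, and the power series $L(q_0),\ldots,L(q_r)$ satisfy the system of $r+1$ equations $$L(q_t)(z)=f_1^{q_t}(z)L(q_{t_1})(z)+f_2^{q_t}(z)L(q_{t_2})(z)+\cdots+f_{s(t)}^{q_t}(z)L(q_{t_{s(t)}})(z)+[q_t\in F],\qquad 0\le t\le r,$$ from which $L(q_0)(z)$ is obtained by solving.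
   Context: An automaton is $\mathcal{M}=(\Sigma,Q,q_0,F,E)$ with possibly infinite alphabet, state set and transition set; $L^{(n)}(\mathcal{M})$ is the number of paths of $n$ transitions from $q_0$ to a final state, and $\mathcal{M}$ is convergent if $L^{(n)}(\mathcal{M})<\infty$ for all $n$; the generating function of $L(\mathcal{M})$ is $\sum_n L^{(n)}(\mathcal{M})z^n$. The counting automaton of $\mathcal{M}$ replaces each transition label by $z$. A transition in parallel from visible state $p$ to visible state $q$ labelled by $f(z)=\sum_{n\ge1} f_nz^n$, $f_n\in\mathbb{N}$, stands for: for each $n\ge1$, $f_n$ disjoint chains of $n$ transitions labelled $z$ from $p$ to $q$ through $n-1$ hidden intermediate states, which are not final and from each of which only the next transition of the chain starts. The counting automaton is presented with transitions in parallel when all transitions are grouped into transitions in parallel between visible states. $[P]$ is $1$ if $P$ holds and $0$ otherwise. -}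

module Defs where

open import Data.Nat using (ℕ; zero; suc; _+_; _*_; _∸_)
open import Data.Fin using (Fin; zero; suc; inject₁; fromℕ)
open import Data.Bool using (Bool; true; false)
open import Data.List using (List; map; upTo)
open import Data.Nat.ListAction using (sum)
open import Relation.Binary.PropositionalEquality using (_≡_)

Series : Set
Series = ℕ → ℕ

_⊛_ : Series → Series → Series
(f ⊛ g) n = sum (map (λ i → f i * g (n ∸ i)) (upTo (suc n)))

_⊕_ : Series → Series → Series
(f ⊕ g) n = f n + g n

zeroS : Series
zeroS _ = 0

ΣS : (s : ℕ) → (Fin s → Series) → Series
ΣS zero    F = zeroS
ΣS (suc s) F = F zero ⊕ ΣS s (λ k → F (suc k))

[_]S : Bool → Series
[ true  ]S zero    = 1
[ true  ]S (suc _) = 0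
[ false ]S _       = 0

-- Visible states: Fin (suc r), visible state  zero  is the initial state q₀.
-- From visible state t start  s t  transitions in parallel; the k-th one
-- leads to visible state  tgt t k  and is labelled by the series  f t k
-- (with f t k 0 = 0, i.e. f = Σ_{n≥1} f_n z^n).

record ParallelPresentation : Set where
  field
    r     : ℕ
    s     : Fin (suc r) → ℕ
    tgt   : (t : Fin (suc r)) → Fin (s t) → Fin (suc r)
    f     : (t : Fin (suc r)) → Fin (s t) → Series
    f-0   : ∀ t k → f t k 0 ≡ 0
    final : Fin (suc r) → Bool

module Expanded (P : ParallelPresentation) where
  open ParallelPresentation P

  -- States of the (expanded) counting automaton.
  -- hid t k m j i : the (i+1)-th hidden intermediate state of the j-th chain
  -- of length (suc m) of the transition in parallel  f t k.
  data State : Set where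
    vis : Fin (suc r) → State
    hid : (t : Fin (suc r)) (k : Fin (s t)) (m : ℕ)
          (j : Fin (f t k (suc m))) (i : Fin m) → State

  -- Transitions (all labelled z), each one a distinct element.
  data Edge : State → State → Set where
    direct : (t : Fin (suc r)) (k : Fin (s t)) (j : Fin (f t k 1)) →
             Edge (vis t) (vis (tgt t k))
    enter  : (t : Fin (suc r)) (k : Fin (s t)) (m : ℕ) (j : Fin (f t k (suc (suc m)))) →
             Edge (vis t) (hid t k (suc m) j zero)
    step   : (t : Fin (suc r)) (k : Fin (s t)) (m : ℕ) (j : Fin (f t k (suc (suc m))))
             (i : Fin m) →
             Edge (hid t k (suc m) j (inject₁ i)) (hid t k (suc m) j (suc i))
    exit   : (t : Fin (suc r)) (k : Fin (s t)) (m : ℕ) (j : Fin (f t k (suc (suc m)))) →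
             Edge (hid t k (suc m) j (fromℕ m)) (vis (tgt t k))

  data IsFinal : State → Set where
    fin : (q : Fin (suc r)) → final q ≡ true → IsFinal (vis q)

  data Path : State → ℕ → Set where
    done : ∀ {q} → IsFinal q → Path q 0
    _∷_  : ∀ {p q n} → Edge p q → Path q n → Path p (suc n)

-- A path from a visible state t is either empty, when t is final, or begins with a
-- complete chain of some transition in parallel f t k, of length i ≥ 1 because
-- f t k 0 = 0, followed by a path of length j from the target tgt t k.  This
-- decomposition is a bijection, and the number of choices of (k, i, j, chain, rest)
-- with i + j = n is the n-th coefficient of Σ_k f t k ⊛ a (tgt t k).

module Submission where

open import Defs
open import Data.Bool using (Bool; true; false)
open import Data.Empty using (⊥-elim)
open import Data.Fin using (Fin; zero; suc; toℕ; inject₁; fromℕ)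
open import Data.Fin.Permutation using (↔⇒≡)
open import Data.Fin.Properties using (+↔⊎; *↔×; ¬Fin0; toℕ<n; toℕ-inject₁; toℕ-fromℕ)
open import Data.Fin.Relation.Unary.Top using (View; view; ‵fromℕ; ‵inj₁; view-fromℕ; view-inject₁)
open import Data.List.Properties using (map-applyUpTo; map-upTo)
open import Data.Nat using (ℕ; zero; suc; _+_; _*_; _∸_; _<_)
open import Data.Nat.ListAction using (sum)
open import Data.Nat.Properties using (+-identityʳ; +-suc; +-cancelˡ-≡; suc-injective; m+n≮m; ≡-irrelevant)
open import Data.Product using (Σ; _×_; _,_)
open import Data.Product.Function.NonDependent.Propositional using (_×-↔_)
open import Data.Sum using (_⊎_; inj₁; inj₂)
open import Data.Sum.Function.Propositional using (_⊎-↔_)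
open import Function using (_∘_)
open import Function.Bundles using (_↔_; mk↔ₛ′)
open import Function.Properties.Inverse using (↔-refl; ↔-sym; ↔-trans)
open import Function.Related.Propositional using (module EquationalReasoning)
open import Relation.Nullary using (¬_)
open import Relation.Binary.PropositionalEquality using (_≡_; _≢_; refl; sym; trans; cong; subst)

private
  variable
    A : Set
    m n : ℕ

¬⇒Fin0↔ : ¬ A → Fin 0 ↔ A
¬⇒Fin0↔ ¬a = mk↔ₛ′ (λ ()) (⊥-elim ∘ ¬a) (⊥-elim ∘ ¬a) (λ ())

Σ-Fin-suc↔ : (B : Fin (suc n) → Set) → Σ (Fin (suc n)) B ↔ (B zero ⊎ Σ (Fin n) (B ∘ suc))
Σ-Fin-suc↔ B = mk↔ₛ′ to from (λ { (inj₁ _) → refl ; (inj₂ _) → refl })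
                              (λ { (zero , _) → refl ; (suc _ , _) → refl })
  where
  to : Σ _ B → B zero ⊎ Σ _ (B ∘ suc)
  to (zero  , b) = inj₁ b
  to (suc i , b) = inj₂ (i , b)
  from : B zero ⊎ Σ _ (B ∘ suc) → Σ _ B
  from (inj₁ b)       = zero , b
  from (inj₂ (i , b)) = suc i , b

ΣS-↔ : (s : ℕ) (F : Fin s → Series) {B : Fin s → Set} →
       (∀ k → Fin (F k n) ↔ B k) → Fin (ΣS s F n) ↔ Σ (Fin s) B
ΣS-↔ zero    F F↔B = ¬⇒Fin0↔ λ { (() , _) }
ΣS-↔ (suc s) F F↔B =
  ↔-trans +↔⊎ (↔-trans (F↔B zero ⊎-↔ ΣS-↔ s (F ∘ suc) (F↔B ∘ suc))
                       (↔-sym (Σ-Fin-suc↔ _)))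

[]S-↔ : (b : Bool) (n : ℕ) → Fin ([ b ]S n) ↔ (n ≡ 0 × b ≡ true)
[]S-↔ true  zero    =
  mk↔ₛ′ (λ _ → refl , refl) (λ _ → zero) (λ { (refl , refl) → refl }) (λ { zero → refl })
[]S-↔ true  (suc n) = ¬⇒Fin0↔ λ { (() , _) }
[]S-↔ false n       = ¬⇒Fin0↔ λ { (_ , ()) }

Convolution : (ℕ → Set) → (ℕ → Set) → ℕ → Set
Convolution A B n = Σ ℕ λ i → Σ ℕ λ j → (i + j ≡ n) × A i × B j

Convolution-zero↔ : {A B : ℕ → Set} → Convolution A B 0 ↔ (A 0 × B 0)
Convolution-zero↔ {A} {B} = mk↔ₛ′ to (λ (a , b) → 0 , 0 , refl , a , b)
                                  (λ _ → refl) (λ { (zero , zero , refl , _) → refl })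
  where
  to : Convolution A B 0 → A 0 × B 0
  to (zero , zero , refl , a , b) = a , b

Convolution-suc↔ : {A B : ℕ → Set} →
  Convolution A B (suc n) ↔ ((A 0 × B (suc n)) ⊎ Convolution (A ∘ suc) B n)
Convolution-suc↔ {n} {A} {B} = mk↔ₛ′ to from to∘from from∘to
  where
  to : Convolution A B (suc n) → (A 0 × B (suc n)) ⊎ Convolution (A ∘ suc) B n
  to (zero  , _ , refl , a , b) = inj₁ (a , b)
  to (suc i , j , e    , a , b) = inj₂ (i , j , suc-injective e , a , b)
  from : (A 0 × B (suc n)) ⊎ Convolution (A ∘ suc) B n → Convolution A B (suc n)
  from (inj₁ (a , b))             = 0 , suc n , refl , a , b
  from (inj₂ (i , j , e , a , b)) = suc i , j , cong suc e , a , b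
  to∘from : ∀ x → to (from x) ≡ x
  to∘from (inj₁ _)                 = refl
  to∘from (inj₂ (i , j , e , a , b)) = cong (λ e → inj₂ (i , j , e , a , b)) (≡-irrelevant _ _)
  from∘to : ∀ x → from (to x) ≡ x
  from∘to (zero  , _ , refl , _) = refl
  from∘to (suc i , j , e , a , b) = cong (λ e → suc i , j , e , a , b) (≡-irrelevant _ _)

⊛-suc : (f g : Series) (n : ℕ) → (f ⊛ g) (suc n) ≡ f 0 * g (suc n) + ((f ∘ suc) ⊛ g) n
⊛-suc f g n = cong (f 0 * g (suc n) +_) (cong sum (trans
  (map-applyUpTo suc (λ i → f i * g (suc n ∸ i)) (suc n))
  (sym (map-upTo (λ i → f (suc i) * g (n ∸ i)) (suc n)))))

⊛-↔ : (f g : Series) {A B : ℕ → Set} → (∀ i → Fin (f i) ↔ A i) → (∀ j → Fin (g j) ↔ B j) →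
      (n : ℕ) → Fin ((f ⊛ g) n) ↔ Convolution A B n
⊛-↔ f g {A} {B} f↔A g↔B zero = begin
  Fin ((f ⊛ g) 0)         ≡⟨ cong Fin (+-identityʳ (f 0 * g 0)) ⟩
  Fin (f 0 * g 0)         ↔⟨ *↔× ⟩
  (Fin (f 0) × Fin (g 0)) ↔⟨ f↔A 0 ×-↔ g↔B 0 ⟩
  (A 0 × B 0)             ↔⟨ Convolution-zero↔ ⟨
  Convolution A B 0       ∎
  where open EquationalReasoning
⊛-↔ f g {A} {B} f↔A g↔B (suc n) = begin
  Fin ((f ⊛ g) (suc n))                                     ≡⟨ cong Fin (⊛-suc f g n) ⟩
  Fin (f 0 * g (suc n) + ((f ∘ suc) ⊛ g) n)                 ↔⟨ +↔⊎ ⟩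
  (Fin (f 0 * g (suc n)) ⊎ Fin (((f ∘ suc) ⊛ g) n))        ↔⟨ ↔-trans *↔× (f↔A 0 ×-↔ g↔B (suc n))
                                                                ⊎-↔ ⊛-↔ (f ∘ suc) g (f↔A ∘ suc) g↔B n ⟩
  ((A 0 × B (suc n)) ⊎ Convolution (A ∘ suc) B n)           ↔⟨ Convolution-suc↔ ⟨
  Convolution A B (suc n)                                   ∎
  where open EquationalReasoning

toℕ-inject₁-+-suc : (i : Fin m) (n : ℕ) → toℕ (inject₁ i) + suc n ≡ toℕ (suc i) + n
toℕ-inject₁-+-suc i n = trans (cong (_+ suc n) (toℕ-inject₁ i)) (+-suc (toℕ i) n)

toℕ-fromℕ-+-suc : (m n : ℕ) → toℕ (fromℕ m) + suc n ≡ suc m + n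
toℕ-fromℕ-+-suc m n = trans (cong (_+ suc n) (toℕ-fromℕ m)) (+-suc m n)

suc-+≢toℕ : (i : Fin (suc m)) (n : ℕ) → suc m + n ≢ toℕ i + 0
suc-+≢toℕ {m} i n e =
  m+n≮m (suc m) n (subst (_< suc m) (sym (trans e (+-identityʳ (toℕ i)))) (toℕ<n i))

module PathDecomposition (P : ParallelPresentation) where
  open ParallelPresentation P
  open Expanded P

  private
    variable
      t : Fin (suc r)
      k : Fin (s t)

  -- From the hidden state i of a chain of length suc (suc m), the chain ends after
  -- suc m − toℕ i more transitions; the equation records this without subtraction.
  ChainExit : (t : Fin (suc r)) → Fin (s t) → (m : ℕ) → Fin (suc m) → ℕ → Set
  ChainExit t k m i n = Σ ℕ λ n′ → (suc m + n′ ≡ toℕ i + n) × Path (vis (tgt t k)) n′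

  ChainExit-≡ : ∀ {t k m n′} (i : Fin (suc m)) (n : ℕ) {q : Path (vis (tgt t k)) n′}
                (e e′ : suc m + n′ ≡ toℕ i + n) →
                _≡_ {A = ChainExit t k m i n} (n′ , e , q) (n′ , e′ , q)
  ChainExit-≡ {n′ = n′} i n {q} e e′ = cong (λ e → n′ , e , q) (≡-irrelevant e e′)

  ChainExit-step : (i : Fin m) → ChainExit t k m (suc i) n → ChainExit t k m (inject₁ i) (suc n)
  ChainExit-step {n = n} i (n′ , e , q) = n′ , trans e (sym (toℕ-inject₁-+-suc i n)) , q

  chain-split : {j : Fin (f t k (suc (suc m)))} {i : Fin (suc m)} →
                Path (hid t k (suc m) j i) n → ChainExit t k m i n
  chain-split (done ())
  chain-split (step t k m j i ∷ p)            = ChainExit-step i (chain-split p)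
  chain-split {n = suc n} (exit t k m j ∷ p) = n , sym (toℕ-fromℕ-+-suc m n) , p

  -- Matching on a path from hid … i cannot refine i, so the inverse recurses on the
  -- top view of i instead.
  chain-join : ∀ {t k m n} {j : Fin (f t k (suc (suc m)))} {i : Fin (suc m)} →
               View i → ChainExit t k m i n → Path (hid t k (suc m) j i) n
  chain-join {n = zero} {i = i} _ (n′ , e , _) = ⊥-elim (suc-+≢toℕ i n′ e)
  chain-join {t} {k} {m} {suc n} {j} ‵fromℕ (n′ , e , q)
    with +-cancelˡ-≡ (suc m) n′ n (trans e (toℕ-fromℕ-+-suc m n))
  ... | refl = exit t k m j ∷ q
  chain-join {t} {k} {m} {suc n} {j} (‵inj₁ {i = i} _) (n′ , e , q) =
    step t k m j i ∷ chain-join (view (suc i)) (n′ , trans e (toℕ-inject₁-+-suc i n) , q)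

  chain-split-join : ∀ {t k m n} {j : Fin (f t k (suc (suc m)))} {i : Fin (suc m)}
                     (v : View i) (x : ChainExit t k m i n) → chain-split {j = j} (chain-join v x) ≡ x
  chain-split-join {n = zero} {i = i} _ (n′ , e , _) = ⊥-elim (suc-+≢toℕ i n′ e)
  chain-split-join {m = m} {n = suc n} ‵fromℕ (n′ , e , q)
    with +-cancelˡ-≡ (suc m) n′ n (trans e (toℕ-fromℕ-+-suc m n))
  ... | refl = ChainExit-≡ (fromℕ m) (suc n) _ _
  chain-split-join {n = suc n} (‵inj₁ {i = i} _) (n′ , e , q) =
    trans (cong (ChainExit-step i) (chain-split-join (view (suc i)) _))
          (ChainExit-≡ (inject₁ i) (suc n) _ _)

  chain-join-split : {j : Fin (f t k (suc (suc m)))} {i : Fin (suc m)}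
                     (p : Path (hid t k (suc m) j i) n) → chain-join (view i) (chain-split p) ≡ p
  chain-join-split (done ())
  chain-join-split (step t k m j i ∷ p) rewrite view-inject₁ i =
    cong (step t k m j i ∷_)
         (trans (cong (chain-join (view (suc i))) (ChainExit-≡ (suc i) _ _ _)) (chain-join-split p))
  chain-join-split {n = suc n} (exit t k m j ∷ p) rewrite view-fromℕ m
    with +-cancelˡ-≡ (suc m) n n (trans (sym (toℕ-fromℕ-+-suc m n)) (toℕ-fromℕ-+-suc m n))
  ... | refl = refl

  Decomposed : Fin (suc r) → ℕ → Set
  Decomposed t n = Σ (Fin (s t)) (λ k → Convolution (Fin ∘ f t k) (Path (vis (tgt t k))) n)
                 ⊎ (n ≡ 0 × final t ≡ true)

  first-chain : (k : Fin (s t)) (m : ℕ) → Fin (f t k (suc (suc m))) →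
                ChainExit t k m zero n → Decomposed t (suc n)
  first-chain k m x (n′ , e , q) = inj₁ (k , suc (suc m) , n′ , cong suc e , x , q)

  decompose : Path (vis t) n → Decomposed t n
  decompose (done (fin t e))    = inj₂ (refl , e)
  decompose (direct t k x ∷ p)  = inj₁ (k , 1 , _ , refl , x , p)
  decompose (enter t k m x ∷ p) = first-chain k m x (chain-split p)

  compose : Decomposed t n → Path (vis t) n
  compose {t} (inj₂ (refl , e))                  = done (fin t e)
  compose {t} (inj₁ (k , 0 , _ , _ , x , _))     = ⊥-elim (¬Fin0 (subst Fin (f-0 t k) x))
  compose {t} (inj₁ (k , 1 , _ , refl , x , p))  = direct t k x ∷ p
  compose {t} {suc n} (inj₁ (k , suc (suc m) , n′ , e , x , q)) =
    enter t k m x ∷ chain-join (view zero) (n′ , suc-injective e , q)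

  decompose-compose : (d : Decomposed t n) → decompose (compose d) ≡ d
  decompose-compose (inj₂ (refl , _))                  = refl
  decompose-compose {t} (inj₁ (k , 0 , _ , _ , x , _)) = ⊥-elim (¬Fin0 (subst Fin (f-0 t k) x))
  decompose-compose (inj₁ (_ , 1 , _ , refl , _))      = refl
  decompose-compose {n = suc n} (inj₁ (k , suc (suc m) , n′ , e , x , q)) =
    trans (cong (first-chain k m x) (chain-split-join (view zero) _))
          (cong (λ e → inj₁ (k , suc (suc m) , n′ , e , x , q)) (≡-irrelevant _ _))

  compose-decompose : (p : Path (vis t) n) → compose (decompose p) ≡ p
  compose-decompose (done (fin _ _))            = refl
  compose-decompose (direct _ _ _ ∷ _)          = refl
  compose-decompose {n = suc n} (enter t k m x ∷ p) =
    cong (enter t k m x ∷_)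
         (trans (cong (chain-join (view zero)) (ChainExit-≡ zero n _ _)) (chain-join-split p))

  path↔ : Path (vis t) n ↔ Decomposed t n
  path↔ = mk↔ₛ′ decompose compose decompose-compose compose-decompose

mainTheorem4 : (P : ParallelPresentation) →
    let open ParallelPresentation P in
    let open Expanded P in
    (a : Fin (suc r) → Series) →
    ((q : Fin (suc r)) (n : ℕ) → Fin (a q n) ↔ Path (vis q) n) →
    (t : Fin (suc r)) (n : ℕ) →
    a t n ≡ (ΣS (s t) (λ k → f t k ⊛ a (tgt t k)) ⊕ [ final t ]S) n
mainTheorem4 P a a↔Path t n = ↔⇒≡ (begin
  Fin (a t n)                 ↔⟨ a↔Path t n ⟩
  Path (vis t) n              ↔⟨ path↔ ⟩
  Decomposed t n              ↔⟨ ΣS-↔ (s t) _ (λ k → ⊛-↔ (f t k) (a (tgt t k)) (λ _ → ↔-refl) (a↔Path (tgt t k)) n)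
                                 ⊎-↔ []S-↔ (final t) n ⟨
  (Fin (ΣS (s t) (λ k → f t k ⊛ a (tgt t k)) n) ⊎ Fin ([ final t ]S n)) ↔⟨ +↔⊎ ⟨
  Fin ((ΣS (s t) (λ k → f t k ⊛ a (tgt t k)) ⊕ [ final t ]S) n) ∎)
  where
  open ParallelPresentation P
  open Expanded P
  open PathDecomposition P
  open EquationalReasoning
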